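{- Let $m\ge 1$. For every integer $n\ge 1$, $$\sum_{k=0}^{\lfloor mn/(m+1)\rfloor}(-1)^{n-k}\binom{n-k}{k}_m\frac{1}{n-k}=\begin{cases}\dfrac{m+1}{n}, & \text{if } m+2\mid n,\\[1ex] -\dfrac{1}{n}, & \text{otherwise.}\end{cases}$$
   Context: Let $p_m(t)=1+t+\cdots+t^m$. For integers $N,k\ge 0$, $\binom{N}{k}_m$ is the coefficient of $t^k$ in $p_m(t)^N$. -}

module Defs where

open import Data.Nat using (ℕ; zero; suc; _∸_)
import Data.Nat as ℕ
open import Data.List using (List; []; _∷_; map; replicate)
open import Data.Integer using (ℤ; +_)
open import Data.Rational using (ℚ; _/_; 0ℚ; 1ℚ; -_; _+_; _*_)

-- Polynomials with natural-number coefficients, as coefficient lists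
-- (constant term first).
Poly : Set
Poly = List ℕ

addP : Poly → Poly → Poly
addP [] q = q
addP (a ∷ p) [] = a ∷ p
addP (a ∷ p) (b ∷ q) = (a ℕ.+ b) ∷ addP p q

mulP : Poly → Poly → Poly
mulP [] q = []
mulP (a ∷ p) q = addP (map (a ℕ.*_) q) (0 ∷ mulP p q)

powP : Poly → ℕ → Poly
powP p zero = 1 ∷ []
powP p (suc N) = mulP p (powP p N)

coeff : Poly → ℕ → ℕ
coeff [] k = 0
coeff (a ∷ p) zero = a
coeff (a ∷ p) (suc k) = coeff p k

pm : ℕ → Poly
pm m = replicate (suc m) 1

binomM : ℕ → ℕ → ℕ → ℕ
binomM m N k = coeff (powP (pm m) N) k

negOnePow : ℕ → ℚ
negOnePow zero = 1ℚ
negOnePow (suc e) = - negOnePow e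

-- 1/d in ℚ for d ≥ 1 (value at d = 0 is an irrelevant convention, never used
-- in the theorem: there d ≥ 1 always)
inv : ℕ → ℚ
inv zero = 0ℚ
inv (suc d) = + 1 / suc d

sumTo : ℕ → (ℕ → ℚ) → ℚ
sumTo zero f = f 0
sumTo (suc b) f = sumTo b f + f (suc b)

lhs : ℕ → ℕ → ℚ
lhs m n = sumTo ((m ℕ.* n) ℕ./ suc m)
  (λ k → negOnePow (n ∸ k) * ((+ binomM m (n ∸ k) k / 1) * inv (n ∸ k)))

{-# OPTIONS --safe #-}

-- Put q = t·p_m(t). Then binom(N,k)_m = [t^(N+k)] q^N, and comparing coefficients in
-- (q^N)′ = N q^(N−1) q′ gives binom(N,k)_m / N = [t^(N+k)] (q^(N−1) t q′) / (N+k).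
-- Hence, writing N = n − k, n times the left-hand side is the coefficient of tⁿ in
-- −∑_{N≥1} (−q)^(N−1) t q′ = −t q′/(1+q) = −t (log (1+q))′. As 1 + q = (1 − t^(m+2))/(1 − t),
-- this series is −t/(1 − t) + (m+2) t^(m+2)/(1 − t^(m+2)), whose n-th coefficient is
-- −1 + (m+2)·[m+2 ∣ n]. In the proof these coefficients come from the recurrence obtained by
-- multiplying with (1 − t)(1 + q) = 1 − t^(m+2). The summands with k > ⌊mn/(m+1)⌋ vanish
-- because then k > m(n − k), the degree of p_m^(n−k).

module Submission where

open import Data.Nat using (ℕ)

module FiniteSums where

  open import Data.Nat as ℕ using (ℕ; zero; suc; _∸_)
  import Data.Nat.Properties as ℕ
  open import Data.Integer using (ℤ; 0ℤ; 1ℤ; _+_; _*_; -_)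
  open import Data.Integer.Properties using (+-identityˡ; +-identityʳ; +-assoc; +-comm; *-zeroʳ; *-distribˡ-+)
  open import Data.Integer.Tactic.RingSolver using (solve-∀)
  open import Relation.Binary.PropositionalEquality
  open ≡-Reasoning

  ∑< : ℕ → (ℕ → ℤ) → ℤ
  ∑< zero    g = 0ℤ
  ∑< (suc K) g = ∑< K g + g K

  syntax ∑< K (λ i → e) = ∑[ i < K ] e

  ∑<-cong : ∀ K {g h : ℕ → ℤ} → (∀ i → i ℕ.< K → g i ≡ h i) → ∑< K g ≡ ∑< K h
  ∑<-cong zero    eq = refl
  ∑<-cong (suc K) eq = cong₂ _+_ (∑<-cong K (λ i i<K → eq i (ℕ.m<n⇒m<1+n i<K))) (eq K ℕ.≤-refl)

  ∑<-zero : ∀ K {g : ℕ → ℤ} → (∀ i → i ℕ.< K → g i ≡ 0ℤ) → ∑< K g ≡ 0ℤ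
  ∑<-zero zero    eq = refl
  ∑<-zero (suc K) eq = cong₂ _+_ (∑<-zero K (λ i i<K → eq i (ℕ.m<n⇒m<1+n i<K))) (eq K ℕ.≤-refl)

  ∑<-+ : ∀ K (g h : ℕ → ℤ) → ∑[ i < K ] (g i + h i) ≡ ∑< K g + ∑< K h
  ∑<-+ zero    g h = refl
  ∑<-+ (suc K) g h = begin
    ∑[ i < K ] (g i + h i) + (g K + h K) ≡⟨ cong (_+ (g K + h K)) (∑<-+ K g h) ⟩
    ∑< K g + ∑< K h + (g K + h K)         ≡⟨ interchange (∑< K g) (∑< K h) (g K) (h K) ⟩
    ∑< K g + g K + (∑< K h + h K)         ∎
    where
    interchange : ∀ a b c d → a + b + (c + d) ≡ a + c + (b + d)
    interchange = solve-∀

  ∑<-*ˡ : ∀ K c (g : ℕ → ℤ) → ∑[ i < K ] (c * g i) ≡ c * ∑< K g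
  ∑<-*ˡ zero    c g = sym (*-zeroʳ c)
  ∑<-*ˡ (suc K) c g =
    trans (cong (_+ c * g K) (∑<-*ˡ K c g)) (sym (*-distribˡ-+ c (∑< K g) (g K)))

  ∑<-swap : ∀ K L (h : ℕ → ℕ → ℤ) → ∑[ i < K ] ∑[ j < L ] h i j ≡ ∑[ j < L ] ∑[ i < K ] h i j
  ∑<-swap zero    L h = sym (∑<-zero L (λ _ _ → refl))
  ∑<-swap (suc K) L h = begin
    ∑[ i < K ] ∑[ j < L ] h i j + ∑[ j < L ] h K j   ≡⟨ cong (_+ ∑[ j < L ] h K j) (∑<-swap K L h) ⟩
    ∑[ j < L ] ∑[ i < K ] h i j + ∑[ j < L ] h K j   ≡⟨ ∑<-+ L _ _ ⟨
    ∑[ j < L ] (∑[ i < K ] h i j + h K j)           ∎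

  ∑<-head : ∀ K (g : ℕ → ℤ) → ∑< (suc K) g ≡ g 0 + ∑[ i < K ] g (suc i)
  ∑<-head zero    g = trans (+-identityˡ (g 0)) (sym (+-identityʳ (g 0)))
  ∑<-head (suc K) g = begin
    ∑< (suc K) g + g (suc K)                   ≡⟨ cong (_+ g (suc K)) (∑<-head K g) ⟩
    g 0 + ∑[ i < K ] g (suc i) + g (suc K)     ≡⟨ +-assoc (g 0) _ _ ⟩
    g 0 + (∑[ i < K ] g (suc i) + g (suc K))   ∎

  ∑<-reverse : ∀ K (g : ℕ → ℤ) → ∑< K g ≡ ∑[ k < K ] g (K ∸ suc k)
  ∑<-reverse zero    g = refl
  ∑<-reverse (suc K) g = begin
    ∑< K g + g K                              ≡⟨ cong (_+ g K) (∑<-reverse K g) ⟩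
    ∑[ k < K ] g (K ∸ suc k) + g K            ≡⟨ +-comm _ (g K) ⟩
    g K + ∑[ k < K ] g (K ∸ suc k)            ≡⟨ ∑<-head K (λ k → g (suc K ∸ suc k)) ⟨
    ∑[ k < suc K ] g (suc K ∸ suc k)          ∎

  sign : ℕ → ℤ
  sign zero    = 1ℤ
  sign (suc j) = - sign j

  ∑<-telescope : ∀ M (a : ℕ → ℤ) → ∑[ j < M ] (sign (suc j) * (a j + a (suc j))) ≡ - a 0 + sign M * a M
  ∑<-telescope zero    a = sym (cancel (a 0))
    where
    cancel : ∀ u → - u + 1ℤ * u ≡ 0ℤ
    cancel = solve-∀
  ∑<-telescope (suc M) a =
    trans (cong (_+ (- sign M * (a M + a (suc M)))) (∑<-telescope M a)) (step (a 0) (sign M) (a M) (a (suc M)))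
    where
    step : ∀ u s v w → - u + s * v + - s * (v + w) ≡ - u + - s * w
    step = solve-∀

module SeriesMultiplication where

  open import Data.Nat as ℕ using (ℕ; zero; suc; _∸_; s≤s)
  import Data.Nat.Properties as ℕ
  open import Data.Integer using (ℤ; +_; -[1+_]; 0ℤ; 1ℤ; _+_; _*_; _-_; -_)
  open import Data.Integer.Properties
    using (+-identityˡ; +-identityʳ; *-identityʳ; *-zeroʳ; *-distribʳ-+; neg-minus-pos; m-n≡m⊖n; ⊖-≥; ⊖-<; pos-+; +-inverseʳ)
  open import Data.Integer.Tactic.RingSolver using (solve-∀)
  open import Data.Sum using (inj₁; inj₂)
  open import Relation.Binary.PropositionalEquality
  open ≡-Reasoning
  open FiniteSums

  -- f : Series stands for ∑ f(k) tᵏ; indexing by ℤ makes multiplication by tⁱ the shift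
  -- x ↦ x − i, with no truncated subtraction. θ is t d/dt.
  Series : Set
  Series = ℤ → ℤ

  mulPoly : ℕ → (ℕ → ℤ) → Series → Series
  mulPoly r c f x = ∑[ i < r ] (c i * f (x - + i))

  one : Series
  one (+ zero) = 1ℤ
  one _        = 0ℤ

  θ : Series → Series
  θ f x = x * f x

  ones : ℕ → ℤ
  ones _ = 1ℤ

  pos-minus-pos-≥ : ∀ {i k} → i ℕ.≤ k → + k - + i ≡ + (k ∸ i)
  pos-minus-pos-≥ {i} {k} i≤k = trans (m-n≡m⊖n k i) (⊖-≥ i≤k)

  pos-minus-pos-< : ∀ {k n} → k ℕ.< n → + k - + n ≡ -[1+ (n ∸ suc k) ]
  pos-minus-pos-< {k} {suc n} (s≤s k≤n) =
    trans (m-n≡m⊖n k (suc n)) (trans (⊖-< (s≤s k≤n)) (cong (λ d → - (+ d)) (ℕ.+-∸-assoc 1 k≤n)))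

  minus-suc : ∀ x i → x - + 1 - + i ≡ x - + suc i
  minus-suc x i = trans (reassoc x (+ i)) (cong (λ y → x - y) (sym (pos-+ 1 i)))
    where
    reassoc : ∀ x y → x - + 1 - y ≡ x - (+ 1 + y)
    reassoc = solve-∀

  mulPoly-cong : ∀ r c {f g : Series} → f ≗ g → mulPoly r c f ≗ mulPoly r c g
  mulPoly-cong r c f≗g x = ∑<-cong r (λ i _ → cong (c i *_) (f≗g (x - + i)))

  mulPoly-congᶜ : ∀ r {c d : ℕ → ℤ} f → (∀ i → i ℕ.< r → c i ≡ d i) → mulPoly r c f ≗ mulPoly r d f
  mulPoly-congᶜ r f c≡d x = ∑<-cong r (λ i i<r → cong (_* f (x - + i)) (c≡d i i<r))

  mulPoly-*ˡ : ∀ r c a (f : Series) x → mulPoly r c (λ y → a * f y) x ≡ a * mulPoly r c f x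
  mulPoly-*ˡ r c a f x =
    trans (∑<-cong r (λ i _ → swap-scalar (c i) a (f (x - + i)))) (∑<-*ˡ r a _)
    where
    swap-scalar : ∀ u a v → u * (a * v) ≡ a * (u * v)
    swap-scalar = solve-∀

  mulPoly-+ᶜ : ∀ r c d (f : Series) x →
    mulPoly r (λ i → c i + d i) f x ≡ mulPoly r c f x + mulPoly r d f x
  mulPoly-+ᶜ r c d f x =
    trans (∑<-cong r (λ i _ → *-distribʳ-+ (f (x - + i)) (c i) (d i))) (∑<-+ r _ _)

  mulPoly-∑ : ∀ r c M (g : ℕ → Series) x →
    mulPoly r c (λ y → ∑[ j < M ] g j y) x ≡ ∑[ j < M ] mulPoly r c (g j) x
  mulPoly-∑ r c M g x =
    trans (∑<-cong r (λ i _ → sym (∑<-*ˡ M (c i) (λ j → g j (x - + i))))) (∑<-swap r M _)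

  mulPoly-comm : ∀ r c s d (f : Series) → mulPoly r c (mulPoly s d f) ≗ mulPoly s d (mulPoly r c f)
  mulPoly-comm r c s d f x = begin
    ∑[ i < r ] (c i * ∑[ j < s ] (d j * f (x - + i - + j)))
      ≡⟨ ∑<-cong r (λ i _ → ∑<-*ˡ s (c i) _) ⟨
    ∑[ i < r ] ∑[ j < s ] (c i * (d j * f (x - + i - + j)))
      ≡⟨ ∑<-swap r s _ ⟩
    ∑[ j < s ] ∑[ i < r ] (c i * (d j * f (x - + i - + j)))
      ≡⟨ ∑<-cong s (λ j _ → ∑<-cong r (λ i _ → exchange (c i) (d j) x (+ i) (+ j))) ⟩
    ∑[ j < s ] ∑[ i < r ] (d j * (c i * f (x - + j - + i)))
      ≡⟨ ∑<-cong s (λ j _ → ∑<-*ˡ r (d j) _) ⟩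
    ∑[ j < s ] (d j * ∑[ i < r ] (c i * f (x - + j - + i)))  ∎
    where
    exchange : ∀ a b x i j → a * (b * f (x - i - j)) ≡ b * (a * f (x - j - i))
    exchange a b x i j = trans (cong (λ y → a * (b * f y)) (reorder x i j)) (swap-scalars a b (f (x - j - i)))
      where
      reorder : ∀ x i j → x - i - j ≡ x - j - i
      reorder = solve-∀
      swap-scalars : ∀ a b v → a * (b * v) ≡ b * (a * v)
      swap-scalars = solve-∀

  mulPoly-θ : ∀ r c (f : Series) x →
    θ (mulPoly r c f) x ≡ mulPoly r c (θ f) x + mulPoly r (λ i → + i * c i) f x
  mulPoly-θ r c f x = begin
    x * ∑[ i < r ] (c i * f (x - + i))            ≡⟨ ∑<-*ˡ r x _ ⟨
    ∑[ i < r ] (x * (c i * f (x - + i)))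
      ≡⟨ ∑<-cong r (λ i _ → leibniz x (+ i) (c i) (f (x - + i))) ⟩
    ∑[ i < r ] (c i * θ f (x - + i) + + i * c i * f (x - + i))  ≡⟨ ∑<-+ r _ _ ⟩
    mulPoly r c (θ f) x + mulPoly r (λ i → + i * c i) f x  ∎
    where
    leibniz : ∀ x i a v → x * (a * v) ≡ a * ((x - i) * v) + i * a * v
    leibniz = solve-∀

  mulPoly-head : ∀ r c (f : Series) x →
    mulPoly (suc r) c f x ≡ c 0 * f x + mulPoly r (λ i → c (suc i)) f (x - + 1)
  mulPoly-head r c f x = trans (∑<-head r (λ i → c i * f (x - + i)))
    (cong₂ (λ y z → c 0 * f y + z) (+-identityʳ x)
      (∑<-cong r (λ i _ → cong (λ y → c (suc i) * f y) (sym (minus-suc x i)))))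

  Causal : Series → Set
  Causal f = ∀ a → f -[1+ a ] ≡ 0ℤ

  mulPoly-causal : ∀ r c (f : Series) → Causal f → Causal (mulPoly r c f)
  mulPoly-causal r c f causal a = ∑<-zero r (λ i _ →
    trans (cong (λ y → c i * f y) (neg-minus-pos a i)) (trans (cong (c i *_) (causal _)) (*-zeroʳ (c i))))

  VanishesAbove : ℕ → Series → Set
  VanishesAbove B f = ∀ k → B ℕ.< k → f (+ k) ≡ 0ℤ

  mulPoly-vanishesAbove : ∀ r c (f : Series) B → VanishesAbove B f → VanishesAbove (r ℕ.+ B) (mulPoly (suc r) c f)
  mulPoly-vanishesAbove r c f B vanishes k r+B<k = ∑<-zero (suc r) (λ i i≤r →
    trans (cong (λ y → c i * f y) (pos-minus-pos-≥ (i≤k (ℕ.≤-pred i≤r))))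
      (trans (cong (c i *_) (vanishes (k ∸ i) (B<k∸i (ℕ.≤-pred i≤r)))) (*-zeroʳ (c i))))
    where
    i≤k : ∀ {i} → i ℕ.≤ r → i ℕ.≤ k
    i≤k i≤r = ℕ.≤-trans i≤r (ℕ.≤-trans (ℕ.m≤m+n r B) (ℕ.<⇒≤ r+B<k))
    B<k∸i : ∀ {i} → i ℕ.≤ r → B ℕ.< k ∸ i
    B<k∸i {i} i≤r = ℕ.m+n≤o⇒m≤o∸n (suc B)
      (ℕ.≤-trans (ℕ.+-monoʳ-≤ (suc B) i≤r) (subst (ℕ._≤ k) (cong suc (ℕ.+-comm r B)) r+B<k))

  one-shift-< : ∀ {i k} → i ℕ.< k → one (+ k - + i) ≡ 0ℤ
  one-shift-< {i} {k} i<k with k ∸ i | pos-minus-pos-≥ {i} {k} (ℕ.<⇒≤ i<k) | ℕ.m<n⇒0<n∸m i<k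
  ... | suc _ | eq | _ = cong one eq

  mulPoly-one-≥ : ∀ r c k → r ℕ.≤ k → mulPoly r c one (+ k) ≡ 0ℤ
  mulPoly-one-≥ r c k r≤k = ∑<-zero r (λ i i<r →
    trans (cong (c i *_) (one-shift-< (ℕ.<-≤-trans i<r r≤k))) (*-zeroʳ (c i)))

  mulPoly-one-< : ∀ r c k → k ℕ.< r → mulPoly r c one (+ k) ≡ c k
  mulPoly-one-< (suc r) c k (s≤s k≤r) with ℕ.m≤n⇒m<n∨m≡n k≤r
  ... | inj₁ k<r = trans (cong₂ _+_ (mulPoly-one-< r c k k<r) (cong (c r *_) (cong one (pos-minus-pos-< k<r))))
                         (trans (cong (λ z → c k + z) (*-zeroʳ (c r))) (+-identityʳ (c k)))
  ... | inj₂ refl = trans (cong₂ _+_ (mulPoly-one-≥ k c k ℕ.≤-refl)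
                                     (trans (cong (λ y → c k * one y) (+-inverseʳ (+ k))) (*-identityʳ (c k))))
                          (+-identityˡ (c k))


module PowersOfPm (m : ℕ) where

  open import Data.Nat as ℕ using (ℕ; zero; suc)
  import Data.Nat.Properties as ℕ
  open import Data.Integer using (ℤ; +_; -[1+_]; 0ℤ; 1ℤ; _+_; _*_; _-_)
  open import Data.Integer.Properties using (+-identityˡ; *-identityˡ; *-identityʳ; *-zeroʳ; pos-+)
  open import Data.Integer.Tactic.RingSolver using (solve; solve-∀)
  open import Data.List using ([]; _∷_)
  open import Relation.Binary.PropositionalEquality
  open ≡-Reasoning
  open FiniteSums
  open SeriesMultiplication

  -- Multiplication by p = p_m, by t p′, by q′ and by 1 + q, where q = t p.
  p· tp′· q′· [1+q]· : Series → Series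
  p·     = mulPoly (suc m) ones
  tp′·   = mulPoly (suc m) (+_)
  q′·    = mulPoly (suc m) (λ i → + suc i)
  [1+q]· = mulPoly (suc (suc m)) ones

  p^ : ℕ → Series
  p^ zero    = one
  p^ (suc N) = p· (p^ N)

  q′·-split : ∀ f x → q′· f x ≡ p· f x + tp′· f x
  q′·-split f x = trans (mulPoly-congᶜ (suc m) f (λ i _ → pos-+ 1 i) x) (mulPoly-+ᶜ (suc m) ones (+_) f x)

  θ-p· : ∀ f x → θ (p· f) x ≡ p· (θ f) x + tp′· f x
  θ-p· f x = trans (mulPoly-θ (suc m) ones f x)
    (cong (λ z → p· (θ f) x + z) (mulPoly-congᶜ (suc m) f (λ i _ → *-identityʳ (+ i)) x))

  θ-p^ : ∀ N x → θ (p^ (suc N)) x ≡ + suc N * tp′· (p^ N) x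
  θ-p^ zero x = begin
    θ (p· one) x                 ≡⟨ θ-p· one x ⟩
    p· (θ one) x + tp′· one x    ≡⟨ cong (_+ tp′· one x) (∑<-zero (suc m) (λ i _ → cong (1ℤ *_) (θ-one (x - + i)))) ⟩
    0ℤ + tp′· one x              ≡⟨ +-identityˡ _ ⟩
    tp′· one x                   ≡⟨ *-identityˡ _ ⟨
    + 1 * tp′· one x             ∎
    where
    θ-one : ∀ y → θ one y ≡ 0ℤ
    θ-one (+ zero)  = refl
    θ-one (+ suc n) = *-zeroʳ (+ suc n)
    θ-one -[1+ n ]  = *-zeroʳ -[1+ n ]
  θ-p^ (suc N) x = begin
    θ (p· (p^ (suc N))) x
      ≡⟨ θ-p· (p^ (suc N)) x ⟩
    p· (θ (p^ (suc N))) x + tp′· (p^ (suc N)) x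
      ≡⟨ cong (_+ tp′· (p^ (suc N)) x) (mulPoly-cong (suc m) ones (θ-p^ N) x) ⟩
    p· (λ y → + suc N * tp′· (p^ N) y) x + tp′· (p^ (suc N)) x
      ≡⟨ cong (_+ tp′· (p^ (suc N)) x) (mulPoly-*ˡ (suc m) ones (+ suc N) (tp′· (p^ N)) x) ⟩
    + suc N * p· (tp′· (p^ N)) x + tp′· (p^ (suc N)) x
      ≡⟨ cong (λ z → + suc N * z + tp′· (p^ (suc N)) x) (mulPoly-comm (suc m) ones (suc m) (+_) (p^ N) x) ⟩
    + suc N * tp′· (p^ (suc N)) x + tp′· (p^ (suc N)) x
      ≡⟨ add-one (+ suc N) (tp′· (p^ (suc N)) x) ⟩
    (+ 1 + + suc N) * tp′· (p^ (suc N)) x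
      ≡⟨ cong (_* tp′· (p^ (suc N)) x) (pos-+ 1 (suc N)) ⟨
    + suc (suc N) * tp′· (p^ (suc N)) x  ∎
    where
    add-one : ∀ a b → a * b + b ≡ (+ 1 + a) * b
    add-one = solve-∀

  p^-causal : ∀ N → Causal (p^ N)
  p^-causal zero    a = refl
  p^-causal (suc N) = mulPoly-causal (suc m) ones (p^ N) (p^-causal N)

  p^-vanishesAbove : ∀ N → VanishesAbove (m ℕ.* N) (p^ N)
  p^-vanishesAbove zero    (suc k) _ = refl
  p^-vanishesAbove (suc N) k mN<k =
    mulPoly-vanishesAbove m ones (p^ N) (m ℕ.* N) (p^-vanishesAbove N) k (subst (ℕ._< k) (ℕ.*-suc m N) mN<k)

  -- Both sides are the coefficient of t^(j+k) in (q^(j+1))′ = (j+1) qʲ q′.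
  q^-derivative-coeff : ∀ j k → + (suc j ℕ.+ k) * p^ (suc j) (+ k) ≡ + suc j * q′· (p^ j) (+ k)
  q^-derivative-coeff j k = begin
    + (suc j ℕ.+ k) * P                       ≡⟨ cong (_* P) (pos-+ (suc j) k) ⟩
    (+ suc j + + k) * P                       ≡⟨ absorb P (+ suc j) (+ k) (tp′· (p^ j) (+ k)) (θ-p^ j (+ k)) ⟩
    + suc j * (P + tp′· (p^ j) (+ k))         ≡⟨ cong (+ suc j *_) (q′·-split (p^ j) (+ k)) ⟨
    + suc j * q′· (p^ j) (+ k)                ∎
    where
    P : ℤ
    P = p^ (suc j) (+ k)
    absorb : ∀ P s k u → k * P ≡ s * u → (s + k) * P ≡ s * (P + u)
    absorb P s k u kP≡su = begin
      (s + k) * P      ≡⟨ solve (s ∷ k ∷ P ∷ []) ⟩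
      s * P + k * P    ≡⟨ cong (λ z → s * P + z) kP≡su ⟩
      s * P + s * u    ≡⟨ solve (s ∷ P ∷ u ∷ []) ⟩
      s * (P + u)      ∎

module TruncatedLogDerivative (m : ℕ) where

  open import Data.Nat as ℕ using (ℕ; zero; suc; _∸_; z≤n; s≤s)
  import Data.Nat.Properties as ℕ
  open import Data.Integer using (ℤ; +_; -[1+_]; 0ℤ; 1ℤ; _+_; _*_; _-_; -_)
  open import Data.Integer.Properties using (*-identityˡ; *-zeroʳ; neg-minus-pos; pos-+; +-inverseʳ)
  open import Data.Integer.Tactic.RingSolver using (solve; solve-∀)
  open import Data.List using ([]; _∷_)
  open import Data.Nat.Divisibility using (_∣_; ∣-refl; >⇒∤; ∣m+n∣m⇒∣n; ∣m∣n⇒∣m+n)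
  open import Data.Nat.Induction using (<-rec)
  open import Data.Product using (_×_; _,_; proj₁; proj₂)
  open import Data.Empty using (⊥-elim)
  open import Relation.Nullary using (¬_)
  open import Relation.Binary.Definitions using (tri<; tri≈; tri>)
  open import Relation.Binary.PropositionalEquality
  open ≡-Reasoning
  open FiniteSums
  open SeriesMultiplication
  open PowersOfPm m

  -- L M = −∑_{j<M} (−q)ʲ t q′ is −t q′/(1+q) truncated at q-degree M; as qᴹ t q′ starts
  -- at t^(M+1), the truncation does not affect the coefficients of t⁰, …, tᴹ.
  q^tq′ : ℕ → Series
  q^tq′ j x = q′· (p^ j) (x - + suc j)

  L : ℕ → Series
  L M x = ∑[ j < M ] (sign (suc j) * q^tq′ j x)

  [1+q]·-split : ∀ f x → [1+q]· f x ≡ f x + p· f (x - + 1)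
  [1+q]·-split f x = trans (mulPoly-head (suc m) ones f x) (cong (_+ p· f (x - + 1)) (*-identityˡ (f x)))

  p·-q^tq′ : ∀ j x → p· (q^tq′ j) (x - + 1) ≡ q^tq′ (suc j) x
  p·-q^tq′ j x = begin
    ∑[ i < suc m ] (1ℤ * q′· (p^ j) (x - + 1 - + i - + suc j))
      ≡⟨ ∑<-cong (suc m) (λ i _ → cong (λ y → 1ℤ * q′· (p^ j) y) (shuffle i)) ⟩
    p· (q′· (p^ j)) (x - + suc (suc j))
      ≡⟨ mulPoly-comm (suc m) ones (suc m) (λ i → + suc i) (p^ j) (x - + suc (suc j)) ⟩
    q^tq′ (suc j) x  ∎
    where
    reassoc : ∀ x a i b → x - a - i - b ≡ x - (a + b) - i
    reassoc = solve-∀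
    shuffle : ∀ i → x - + 1 - + i - + suc j ≡ x - + suc (suc j) - + i
    shuffle i = trans (reassoc x (+ 1) (+ i) (+ suc j)) (cong (λ z → x - z - + i) (sym (pos-+ 1 (suc j))))

  [1+q]·-L : ∀ M x → [1+q]· (L M) x ≡ - q^tq′ 0 x + sign M * q^tq′ M x
  [1+q]·-L M x = begin
    [1+q]· (L M) x
      ≡⟨ mulPoly-∑ (suc (suc m)) ones M (λ j y → sign (suc j) * q^tq′ j y) x ⟩
    ∑[ j < M ] [1+q]· (λ y → sign (suc j) * q^tq′ j y) x
      ≡⟨ ∑<-cong M (λ j _ → trans (mulPoly-*ˡ (suc (suc m)) ones (sign (suc j)) (q^tq′ j) x)
                                   (cong (sign (suc j) *_) ([1+q]·-q^tq′ j))) ⟩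
    ∑[ j < M ] (sign (suc j) * (q^tq′ j x + q^tq′ (suc j) x))
      ≡⟨ ∑<-telescope M (λ j → q^tq′ j x) ⟩
    - q^tq′ 0 x + sign M * q^tq′ M x  ∎
    where
    [1+q]·-q^tq′ : ∀ j → [1+q]· (q^tq′ j) x ≡ q^tq′ j x + q^tq′ (suc j) x
    [1+q]·-q^tq′ j = trans ([1+q]·-split (q^tq′ j) x) (cong (λ z → q^tq′ j x + z) (p·-q^tq′ j x))

  q′·p^-causal : ∀ j → Causal (q′· (p^ j))
  q′·p^-causal j = mulPoly-causal (suc m) (λ i → + suc i) (p^ j) (p^-causal j)

  q^tq′-causal : ∀ j → Causal (q^tq′ j)
  q^tq′-causal j a = trans (cong (q′· (p^ j)) (neg-minus-pos a (suc j))) (q′·p^-causal j _)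

  q^tq′-≤ : ∀ j k → k ℕ.≤ j → q^tq′ j (+ k) ≡ 0ℤ
  q^tq′-≤ j k k≤j = trans (cong (q′· (p^ j)) (pos-minus-pos-< (s≤s k≤j))) (q′·p^-causal j _)

  q^tq′-0-≤ : ∀ k → k ℕ.≤ suc m → q^tq′ 0 (+ k) ≡ + k
  q^tq′-0-≤ zero    _         = q^tq′-≤ 0 0 z≤n
  q^tq′-0-≤ (suc k) (s≤s k≤m) = mulPoly-one-< (suc m) (λ i → + suc i) k (s≤s k≤m)

  q^tq′-0-> : ∀ k → suc m ℕ.< k → q^tq′ 0 (+ k) ≡ 0ℤ
  q^tq′-0-> (suc k) (s≤s m<k) = mulPoly-one-≥ (suc m) (λ i → + suc i) k m<k

  L-causal : ∀ M → Causal (L M)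
  L-causal M a = ∑<-zero M (λ j _ → trans (cong (sign (suc j) *_) (q^tq′-causal j a)) (*-zeroʳ (sign (suc j))))

  L-zero : ∀ M → L M (+ 0) ≡ 0ℤ
  L-zero M = ∑<-zero M (λ j _ → trans (cong (sign (suc j) *_) (q^tq′-≤ j 0 z≤n)) (*-zeroʳ (sign (suc j))))

  [1+q]·-L-≤ : ∀ M k → k ℕ.≤ M → [1+q]· (L M) (+ k) ≡ - q^tq′ 0 (+ k)
  [1+q]·-L-≤ M k k≤M = trans ([1+q]·-L M (+ k))
    (trans (cong (λ z → - q^tq′ 0 (+ k) + sign M * z) (q^tq′-≤ M k k≤M)) (drop-zero (q^tq′ 0 (+ k)) (sign M)))
    where
    drop-zero : ∀ a s → - a + s * 0ℤ ≡ - a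
    drop-zero = solve-∀

  -- Multiplying by 1 − t turns 1 + q into 1 − t^(m+2).
  L-recurrence : ∀ M k → suc k ℕ.≤ M →
    L M (+ suc k) ≡ L M (+ k - + suc m) + q^tq′ 0 (+ k) - q^tq′ 0 (+ suc k)
  L-recurrence M k sk≤M =
    solve-for (L M (+ suc k)) (p· (L M) (+ k)) (L M (+ k - + suc m)) (q^tq′ 0 (+ k)) (q^tq′ 0 (+ suc k)) upper lower
    where
    solve-for : ∀ a t b r s → a + t ≡ - s → t + 1ℤ * b ≡ - r → a ≡ b + r - s
    solve-for a t b r s a+t≡-s t+b≡-r = begin
      a                          ≡⟨ solve (a ∷ t ∷ b ∷ []) ⟩
      (a + t) - (t + 1ℤ * b) + b ≡⟨ cong₂ (λ u v → u - v + b) a+t≡-s t+b≡-r ⟩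
      - s - - r + b              ≡⟨ solve (s ∷ r ∷ b ∷ []) ⟩
      b + r - s                  ∎
    upper : L M (+ suc k) + p· (L M) (+ k) ≡ - q^tq′ 0 (+ suc k)
    upper = trans (sym ([1+q]·-split (L M) (+ suc k))) ([1+q]·-L-≤ M (suc k) sk≤M)
    -- [1+q]· f x unfolds to p· f x + 1ℤ * f (x - + suc m).
    lower : p· (L M) (+ k) + 1ℤ * L M (+ k - + suc m) ≡ - q^tq′ 0 (+ k)
    lower = [1+q]·-L-≤ M k (ℕ.≤-trans (ℕ.n≤1+n k) sk≤M)

  L-head : ∀ M k → k ℕ.< suc m → suc k ℕ.≤ M → L M (+ suc k) ≡ -[1+ 0 ]
  L-head M k k<sm sk≤M = begin
    L M (+ suc k)
      ≡⟨ L-recurrence M k sk≤M ⟩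
    L M (+ k - + suc m) + q^tq′ 0 (+ k) - q^tq′ 0 (+ suc k)
      ≡⟨ cong₂ (λ a b → a + b - q^tq′ 0 (+ suc k))
               (trans (cong (L M) (pos-minus-pos-< k<sm)) (L-causal M _)) (q^tq′-0-≤ k (ℕ.<⇒≤ k<sm)) ⟩
    0ℤ + + k - q^tq′ 0 (+ suc k)
      ≡⟨ cong (λ z → 0ℤ + + k - z) (trans (q^tq′-0-≤ (suc k) k<sm) (pos-+ 1 k)) ⟩
    0ℤ + + k - (+ 1 + + k)
      ≡⟨ step-down (+ k) ⟩
    -[1+ 0 ]  ∎
    where
    step-down : ∀ a → 0ℤ + a - (+ 1 + a) ≡ - + 1
    step-down = solve-∀

  L-at-period : ∀ M → suc (suc m) ℕ.≤ M → L M (+ suc (suc m)) ≡ + suc m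
  L-at-period M period≤M = begin
    L M (+ suc (suc m))
      ≡⟨ L-recurrence M (suc m) period≤M ⟩
    L M (+ suc m - + suc m) + q^tq′ 0 (+ suc m) - q^tq′ 0 (+ suc (suc m))
      ≡⟨ cong₂ (λ a b → a + b - q^tq′ 0 (+ suc (suc m)))
               (trans (cong (L M) (+-inverseʳ (+ suc m))) (L-zero M)) (q^tq′-0-≤ (suc m) ℕ.≤-refl) ⟩
    0ℤ + + suc m - q^tq′ 0 (+ suc (suc m))
      ≡⟨ cong (λ z → 0ℤ + + suc m - z) (q^tq′-0-> (suc (suc m)) ℕ.≤-refl) ⟩
    0ℤ + + suc m - 0ℤ
      ≡⟨ drop-zeros (+ suc m) ⟩
    + suc m  ∎
    where
    drop-zeros : ∀ a → 0ℤ + a - 0ℤ ≡ a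
    drop-zeros = solve-∀

  L-periodic : ∀ M k → suc m ℕ.< k → suc k ℕ.≤ M → L M (+ suc k) ≡ L M (+ (k ∸ suc m))
  L-periodic M k sm<k sk≤M = begin
    L M (+ suc k)
      ≡⟨ L-recurrence M k sk≤M ⟩
    L M (+ k - + suc m) + q^tq′ 0 (+ k) - q^tq′ 0 (+ suc k)
      ≡⟨ cong₂ (λ a b → a + b - q^tq′ 0 (+ suc k))
               (cong (L M) (pos-minus-pos-≥ (ℕ.<⇒≤ sm<k))) (q^tq′-0-> k sm<k) ⟩
    L M (+ (k ∸ suc m)) + 0ℤ - q^tq′ 0 (+ suc k)
      ≡⟨ cong (λ z → L M (+ (k ∸ suc m)) + 0ℤ - z) (q^tq′-0-> (suc k) (ℕ.m<n⇒m<1+n sm<k)) ⟩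
    L M (+ (k ∸ suc m)) + 0ℤ - 0ℤ
      ≡⟨ drop-zeros (L M (+ (k ∸ suc m))) ⟩
    L M (+ (k ∸ suc m))  ∎
    where
    drop-zeros : ∀ a → a + 0ℤ - 0ℤ ≡ a
    drop-zeros = solve-∀

  LValueAt : ℕ → ℕ → Set
  LValueAt M n = (suc (suc m) ∣ n → L M (+ n) ≡ + suc m) × (¬ (suc (suc m) ∣ n) → L M (+ n) ≡ -[1+ 0 ])

  L-value : ∀ M n → 1 ℕ.≤ n → n ℕ.≤ M → LValueAt M n
  L-value M = <-rec (λ n → 1 ℕ.≤ n → n ℕ.≤ M → LValueAt M n) step
    where
    step : ∀ n → (∀ {t} → t ℕ.< n → 1 ℕ.≤ t → t ℕ.≤ M → LValueAt M t) → 1 ℕ.≤ n → n ℕ.≤ M → LValueAt M n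
    step (suc k) ih _ n≤M with ℕ.<-cmp k (suc m)
    ... | tri< k<sm _ _ = (λ period∣n → ⊥-elim (>⇒∤ (s≤s k<sm) period∣n)) , (λ _ → L-head M k k<sm n≤M)
    ... | tri≈ _ refl _ = (λ _ → L-at-period M n≤M) , (λ period∤n → ⊥-elim (period∤n ∣-refl))
    ... | tri> _ _ sm<k =
        (λ period∣n → trans shift (proj₁ ih-t (∣m+n∣m⇒∣n (subst (suc (suc m) ∣_) (sym split) period∣n) ∣-refl)))
      , (λ period∤n → trans shift (proj₂ ih-t (λ period∣t → period∤n (subst (suc (suc m) ∣_) split (∣m∣n⇒∣m+n ∣-refl period∣t)))))
      where
      t : ℕ
      t = k ∸ suc m
      split : suc (suc m) ℕ.+ t ≡ suc k
      split = cong suc (ℕ.m+[n∸m]≡n (ℕ.<⇒≤ sm<k))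
      t<n : t ℕ.< suc k
      t<n = s≤s (ℕ.m∸n≤m k (suc m))
      ih-t : LValueAt M t
      ih-t = ih t<n (ℕ.m<n⇒0<n∸m sm<k) (ℕ.≤-trans (ℕ.<⇒≤ t<n) n≤M)
      shift : L M (+ suc k) ≡ L M (+ t)
      shift = L-periodic M k sm<k n≤M

module RationalEmbedding where

  open import Data.Nat as ℕ using (ℕ; zero; suc; z≤n)
  import Data.Nat.Properties as ℕ
  open import Data.Integer as ℤ using (ℤ; +_; -[1+_])
  import Data.Integer.Properties as ℤ
  open import Data.Rational using (ℚ; _/_; 0ℚ; 1ℚ; -_; _+_; _*_; fromℚᵘ)
  import Data.Rational.Properties as ℚ
  open import Data.Rational.Unnormalised as ℚᵘ using (mkℚᵘ; *≡*)
  import Data.Rational.Unnormalised.Properties as ℚᵘ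
  open import Data.Sum using (inj₁; inj₂)
  open import Relation.Binary.PropositionalEquality
  open import Defs using (inv; sumTo)
  open FiniteSums

  toℚ : ℤ → ℚ
  toℚ a = a / 1

  fromℚᵘ-+ : ∀ p q → fromℚᵘ (p ℚᵘ.+ q) ≡ fromℚᵘ p + fromℚᵘ q
  fromℚᵘ-+ p q = ℚ.toℚᵘ-injective (ℚᵘ.≃-trans (ℚ.toℚᵘ-fromℚᵘ (p ℚᵘ.+ q))
    (ℚᵘ.≃-sym (ℚᵘ.≃-trans (ℚ.toℚᵘ-homo-+ (fromℚᵘ p) (fromℚᵘ q)) (ℚᵘ.+-cong (ℚ.toℚᵘ-fromℚᵘ p) (ℚ.toℚᵘ-fromℚᵘ q)))))

  fromℚᵘ-* : ∀ p q → fromℚᵘ (p ℚᵘ.* q) ≡ fromℚᵘ p * fromℚᵘ q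
  fromℚᵘ-* p q = ℚ.toℚᵘ-injective (ℚᵘ.≃-trans (ℚ.toℚᵘ-fromℚᵘ (p ℚᵘ.* q))
    (ℚᵘ.≃-sym (ℚᵘ.≃-trans (ℚ.toℚᵘ-homo-* (fromℚᵘ p) (fromℚᵘ q)) (ℚᵘ.*-cong (ℚ.toℚᵘ-fromℚᵘ p) (ℚ.toℚᵘ-fromℚᵘ q)))))

  fromℚᵘ-neg : ∀ p → fromℚᵘ (ℚᵘ.- p) ≡ - fromℚᵘ p
  fromℚᵘ-neg p = ℚ.toℚᵘ-injective (ℚᵘ.≃-trans (ℚ.toℚᵘ-fromℚᵘ (ℚᵘ.- p))
    (ℚᵘ.≃-sym (ℚᵘ.≃-trans (ℚ.toℚᵘ-homo‿- (fromℚᵘ p)) (ℚᵘ.-‿cong (ℚ.toℚᵘ-fromℚᵘ p)))))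

  toℚ-+ : ∀ a b → toℚ (a ℤ.+ b) ≡ toℚ a + toℚ b
  toℚ-+ a b = trans (ℚ.fromℚᵘ-cong {mkℚᵘ (a ℤ.+ b) 0} {mkℚᵘ a 0 ℚᵘ.+ mkℚᵘ b 0} (*≡* (cross a b)))
                    (fromℚᵘ-+ (mkℚᵘ a 0) (mkℚᵘ b 0))
    where
    cross : ∀ a b → (a ℤ.+ b) ℤ.* + 1 ≡ (a ℤ.* + 1 ℤ.+ b ℤ.* + 1) ℤ.* + 1
    cross a b = trans (ℤ.*-identityʳ _)
      (trans (cong₂ ℤ._+_ (sym (ℤ.*-identityʳ a)) (sym (ℤ.*-identityʳ b))) (sym (ℤ.*-identityʳ _)))

  toℚ-* : ∀ a b → toℚ (a ℤ.* b) ≡ toℚ a * toℚ b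
  toℚ-* a b = trans (ℚ.fromℚᵘ-cong {mkℚᵘ (a ℤ.* b) 0} {mkℚᵘ a 0 ℚᵘ.* mkℚᵘ b 0} (*≡* refl)) (fromℚᵘ-* (mkℚᵘ a 0) (mkℚᵘ b 0))

  toℚ-neg : ∀ a → toℚ (ℤ.- a) ≡ - toℚ a
  toℚ-neg a = fromℚᵘ-neg (mkℚᵘ a 0)

  toℚ-*-inv : ∀ a b c d → a ℤ.* + suc d ≡ b ℤ.* + suc c → toℚ a * inv (suc c) ≡ toℚ b * inv (suc d)
  toℚ-*-inv a b c d ad≡bc = trans (sym (fromℚᵘ-* (mkℚᵘ a 0) (mkℚᵘ (+ 1) c)))
    (trans (ℚ.fromℚᵘ-cong {mkℚᵘ a 0 ℚᵘ.* mkℚᵘ (+ 1) c} {mkℚᵘ b 0 ℚᵘ.* mkℚᵘ (+ 1) d} (*≡* cross))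
           (fromℚᵘ-* (mkℚᵘ b 0) (mkℚᵘ (+ 1) d)))
    where
    cross : (a ℤ.* + 1) ℤ.* + suc (d ℕ.+ 0) ≡ (b ℤ.* + 1) ℤ.* + suc (c ℕ.+ 0)
    cross rewrite ℕ.+-identityʳ c | ℕ.+-identityʳ d | ℤ.*-identityʳ a | ℤ.*-identityʳ b = ad≡bc

  toℚ-[-1]* : ∀ q → toℚ -[1+ 0 ] * q ≡ - q
  toℚ-[-1]* q = trans (cong (_* q) (toℚ-neg (+ 1))) (trans (sym (ℚ.neg-distribˡ-* 1ℚ q)) (cong -_ (ℚ.*-identityˡ q)))

  sumTo-cong : ∀ K (f g : ℕ → ℚ) → (∀ k → k ℕ.≤ K → f k ≡ g k) → sumTo K f ≡ sumTo K g
  sumTo-cong zero    f g eq = eq 0 z≤n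
  sumTo-cong (suc K) f g eq =
    cong₂ _+_ (sumTo-cong K f g (λ k k≤K → eq k (ℕ.m≤n⇒m≤1+n k≤K))) (eq (suc K) ℕ.≤-refl)

  sumTo-extend : ∀ b c (f : ℕ → ℚ) → b ℕ.≤ c → (∀ j → b ℕ.< j → j ℕ.≤ c → f j ≡ 0ℚ) → sumTo c f ≡ sumTo b f
  sumTo-extend b zero    f z≤n _ = refl
  sumTo-extend b (suc c) f b≤c vanish with ℕ.m≤n⇒m<n∨m≡n b≤c
  ... | inj₂ refl = refl
  ... | inj₁ (ℕ.s≤s b≤c′) = trans
    (cong₂ _+_ (sumTo-extend b c f b≤c′ (λ j b<j j≤c → vanish j b<j (ℕ.m≤n⇒m≤1+n j≤c))) (vanish (suc c) (ℕ.s≤s b≤c′) ℕ.≤-refl))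
    (ℚ.+-identityʳ _)

  sumTo-toℚ : ∀ K (s : ℕ → ℤ) c → sumTo K (λ k → toℚ (s k) * c) ≡ toℚ (∑< (suc K) s) * c
  sumTo-toℚ zero    s c = cong (λ z → toℚ z * c) (sym (ℤ.+-identityˡ (s 0)))
  sumTo-toℚ (suc K) s c = trans (cong (_+ toℚ (s (suc K)) * c) (sumTo-toℚ K s c))
    (trans (sym (ℚ.*-distribʳ-+ c (toℚ (∑< (suc K) s)) (toℚ (s (suc K)))))
           (cong (_* c) (sym (toℚ-+ (∑< (suc K) s) (s (suc K))))))

module CoefficientSeries where

  open import Data.Nat as ℕ using (ℕ; zero; suc; z≤n; s≤s)
  import Data.Nat.Properties as ℕ
  open import Data.Integer using (ℤ; +_; -[1+_]; 0ℤ; 1ℤ; _+_; _*_; _-_)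
  open import Data.Integer.Properties using (*-identityˡ; pos-+; neg-minus-pos)
  open import Data.List using ([]; _∷_; map; replicate)
  open import Relation.Binary.PropositionalEquality
  open ≡-Reasoning
  open import Defs using (Poly; addP; mulP; coeff)
  open SeriesMultiplication

  coeffSeries : Poly → Series
  coeffSeries p (+ k)    = + coeff p k
  coeffSeries p -[1+ _ ] = 0ℤ

  coeff-addP : ∀ p q k → coeff (addP p q) k ≡ coeff p k ℕ.+ coeff q k
  coeff-addP []      q       k       = refl
  coeff-addP (a ∷ p) []      k       = sym (ℕ.+-identityʳ _)
  coeff-addP (a ∷ p) (b ∷ q) zero    = refl
  coeff-addP (a ∷ p) (b ∷ q) (suc k) = coeff-addP p q k

  coeff-map-1* : ∀ q k → coeff (map (1 ℕ.*_) q) k ≡ coeff q k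
  coeff-map-1* []      k       = refl
  coeff-map-1* (b ∷ q) zero    = ℕ.*-identityˡ b
  coeff-map-1* (b ∷ q) (suc k) = coeff-map-1* q k

  coeffSeries-shift : ∀ p x → coeffSeries (0 ∷ p) x ≡ coeffSeries p (x - + 1)
  coeffSeries-shift p (+ zero)  = refl
  coeffSeries-shift p (+ suc k) = cong (coeffSeries p) (sym (pos-minus-pos-≥ {1} {suc k} (s≤s z≤n)))
  coeffSeries-shift p -[1+ a ]  = cong (coeffSeries p) (sym (neg-minus-pos a 1))

  coeffSeries-addP : ∀ p q x → coeffSeries (addP p q) x ≡ coeffSeries p x + coeffSeries q x
  coeffSeries-addP p q (+ k)    = trans (cong +_ (coeff-addP p q k)) (pos-+ (coeff p k) (coeff q k))
  coeffSeries-addP p q -[1+ _ ] = refl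

  coeffSeries-mulP-replicate : ∀ r q → coeffSeries (mulP (replicate r 1) q) ≗ mulPoly r ones (coeffSeries q)
  coeffSeries-mulP-replicate zero    q (+ k)    = refl
  coeffSeries-mulP-replicate zero    q -[1+ a ] = refl
  coeffSeries-mulP-replicate (suc r) q x = begin
    coeffSeries (addP (map (1 ℕ.*_) q) (0 ∷ mulP (replicate r 1) q)) x
      ≡⟨ coeffSeries-addP (map (1 ℕ.*_) q) _ x ⟩
    coeffSeries (map (1 ℕ.*_) q) x + coeffSeries (0 ∷ mulP (replicate r 1) q) x
      ≡⟨ cong₂ _+_ (unit x) (trans (coeffSeries-shift _ x) (coeffSeries-mulP-replicate r q (x - + 1))) ⟩
    1ℤ * coeffSeries q x + mulPoly r ones (coeffSeries q) (x - + 1)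
      ≡⟨ mulPoly-head r ones (coeffSeries q) x ⟨
    mulPoly (suc r) ones (coeffSeries q) x  ∎
    where
    unit : ∀ x → coeffSeries (map (1 ℕ.*_) q) x ≡ 1ℤ * coeffSeries q x
    unit (+ k)    = trans (cong +_ (coeff-map-1* q k)) (sym (*-identityˡ _))
    unit -[1+ _ ] = refl

module FloorBounds where

  open import Data.Nat using (ℕ; suc; _+_; _*_; _∸_; _≤_; _<_; s≤s)
  open import Data.Nat.Properties
  open import Data.Nat.DivMod using (_/_; _%_; m<n*o⇒m/o<n; m≡m%n+[m/n]*n; m%n<n)
  open import Relation.Binary.PropositionalEquality

  ⌊mn/[m+1]⌋<n : ∀ m n → (m * suc n) / suc m < suc n
  ⌊mn/[m+1]⌋<n m n = m<n*o⇒m/o<n (subst₂ _<_ (*-comm (suc n) m) (sym (*-suc (suc n) m))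
    (s≤s (m≤n+m (m + n * m) n)))

  ⌊mn/[m+1]⌋<k⇒m[n∸k]<k : ∀ m n k → k ≤ n → (m * n) / suc m < k → m * (n ∸ k) < k
  ⌊mn/[m+1]⌋<k⇒m[n∸k]<k m n k k≤n B<k = +-cancelʳ-< (m * k) (m * (n ∸ k)) k (subst (_< k + m * k) split mn<k+mk)
    where
    B : ℕ
    B = (m * n) / suc m
    mn<[B+1][m+1] : m * n < suc B * suc m
    mn<[B+1][m+1] = subst (_< suc B * suc m) (sym (m≡m%n+[m/n]*n (m * n) (suc m)))
                          (+-monoˡ-< (B * suc m) (m%n<n (m * n) (suc m)))
    mn<k+mk : m * n < k + m * k
    mn<k+mk = <-≤-trans mn<[B+1][m+1]
      (subst (suc B * suc m ≤_) (trans (*-suc k m) (cong (k +_) (*-comm k m))) (*-monoˡ-≤ (suc m) B<k))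
    split : m * n ≡ m * (n ∸ k) + m * k
    split = trans (cong (m *_) (sym (m∸n+n≡m k≤n))) (*-distribˡ-+ m (n ∸ k) k)

module LeftHandSide (m : ℕ) where

  open import Data.Nat as ℕ using (ℕ; zero; suc; _∸_; s≤s)
  import Data.Nat.Properties as ℕ
  import Data.Nat.DivMod as ℕ
  open import Data.Integer as ℤ using (ℤ; +_; -[1+_])
  import Data.Integer.Properties as ℤ
  open import Data.Rational using (ℚ; _/_; 0ℚ; -_; _*_)
  import Data.Rational.Properties as ℚ
  open import Relation.Binary.PropositionalEquality
  open ≡-Reasoning
  open import Defs using (powP; pm; binomM; negOnePow; inv; sumTo; lhs)
  open FiniteSums
  open SeriesMultiplication
  open PowersOfPm m
  open TruncatedLogDerivative m
  open RationalEmbedding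
  open CoefficientSeries
  open FloorBounds

  coeffSeries-powP : ∀ N → coeffSeries (powP (pm m) N) ≗ p^ N
  coeffSeries-powP zero (+ zero)        = refl
  coeffSeries-powP zero (+ suc zero)    = refl
  coeffSeries-powP zero (+ suc (suc _)) = refl
  coeffSeries-powP zero -[1+ _ ]        = refl
  coeffSeries-powP (suc N) x = trans (coeffSeries-mulP-replicate (suc m) (powP (pm m) N) x)
                                     (mulPoly-cong (suc m) ones (coeffSeries-powP N) x)

  binomM-≡-p^ : ∀ N k → + binomM m N k ≡ p^ N (+ k)
  binomM-≡-p^ N k = coeffSeries-powP N (+ k)

  negOnePow-≡-sign : ∀ N → negOnePow N ≡ toℚ (sign N)
  negOnePow-≡-sign zero    = refl
  negOnePow-≡-sign (suc N) = trans (cong -_ (negOnePow-≡-sign N)) (sym (toℚ-neg (sign N)))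

  binomM-over-N : ∀ j k →
    toℚ (+ binomM m (suc j) k) * inv (suc j) ≡ toℚ (q′· (p^ j) (+ k)) * inv (suc j ℕ.+ k)
  binomM-over-N j k = toℚ-*-inv (+ binomM m (suc j) k) (q′· (p^ j) (+ k)) j (j ℕ.+ k) (begin
    + binomM m (suc j) k ℤ.* + (suc j ℕ.+ k)   ≡⟨ cong (ℤ._* + (suc j ℕ.+ k)) (binomM-≡-p^ (suc j) k) ⟩
    p^ (suc j) (+ k) ℤ.* + (suc j ℕ.+ k)       ≡⟨ ℤ.*-comm _ (+ (suc j ℕ.+ k)) ⟩
    + (suc j ℕ.+ k) ℤ.* p^ (suc j) (+ k)       ≡⟨ q^-derivative-coeff j k ⟩
    + suc j ℤ.* q′· (p^ j) (+ k)               ≡⟨ ℤ.*-comm (+ suc j) _ ⟩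
    q′· (p^ j) (+ k) ℤ.* + suc j               ∎)

  summand : ℕ → ℕ → ℚ
  summand n k = negOnePow (n ∸ k) * ((+ binomM m (n ∸ k) k / 1) * inv (n ∸ k))

  scaledSummand : ℕ → ℕ → ℤ
  scaledSummand n′ k = sign (suc (n′ ∸ k)) ℤ.* q′· (p^ (n′ ∸ k)) (+ k)

  summand-≡-scaledSummand : ∀ n′ k → k ℕ.≤ n′ → summand (suc n′) k ≡ toℚ (scaledSummand n′ k) * inv (suc n′)
  summand-≡-scaledSummand n′ k k≤n′ rewrite ℕ.+-∸-assoc 1 k≤n′ = begin
    negOnePow (suc j) * (toℚ (+ binomM m (suc j) k) * inv (suc j))
      ≡⟨ cong₂ _*_ (negOnePow-≡-sign (suc j)) (binomM-over-N j k) ⟩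
    toℚ (sign (suc j)) * (toℚ (q′· (p^ j) (+ k)) * inv (suc j ℕ.+ k))
      ≡⟨ ℚ.*-assoc (toℚ (sign (suc j))) (toℚ (q′· (p^ j) (+ k))) (inv (suc j ℕ.+ k)) ⟨
    toℚ (sign (suc j)) * toℚ (q′· (p^ j) (+ k)) * inv (suc j ℕ.+ k)
      ≡⟨ cong₂ _*_ (sym (toℚ-* (sign (suc j)) _)) (cong (λ d → inv (suc d)) (ℕ.m∸n+n≡m k≤n′)) ⟩
    toℚ (sign (suc j) ℤ.* q′· (p^ j) (+ k)) * inv (suc n′)  ∎
    where
    j : ℕ
    j = n′ ∸ k

  summand-vanishes : ∀ n k → (m ℕ.* n) ℕ./ suc m ℕ.< k → k ℕ.≤ n → summand n k ≡ 0ℚ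
  summand-vanishes n k B<k k≤n = begin
    summand n k
      ≡⟨ cong (λ c → negOnePow (n ∸ k) * ((+ c / 1) * inv (n ∸ k))) binomM≡0 ⟩
    negOnePow (n ∸ k) * (0ℚ * inv (n ∸ k))  ≡⟨ cong (negOnePow (n ∸ k) *_) (ℚ.*-zeroˡ (inv (n ∸ k))) ⟩
    negOnePow (n ∸ k) * 0ℚ                  ≡⟨ ℚ.*-zeroʳ (negOnePow (n ∸ k)) ⟩
    0ℚ                                      ∎
    where
    binomM≡0 : binomM m (n ∸ k) k ≡ 0
    binomM≡0 = ℤ.+-injective (trans (binomM-≡-p^ (n ∸ k) k)
      (p^-vanishesAbove (n ∸ k) k (⌊mn/[m+1]⌋<k⇒m[n∸k]<k m n k k≤n B<k)))

  L-diagonal : ∀ n′ → L (suc n′) (+ suc n′) ≡ ∑< (suc n′) (scaledSummand n′)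
  L-diagonal n′ = trans (∑<-reverse (suc n′) (λ j → sign (suc j) ℤ.* q^tq′ j (+ suc n′)))
    (∑<-cong (suc n′) (λ k k<n → cong (λ x → sign (suc (n′ ∸ k)) ℤ.* q′· (p^ (n′ ∸ k)) x) (index k (ℕ.≤-pred k<n))))
    where
    index : ∀ k → k ℕ.≤ n′ → + suc n′ ℤ.- + suc (n′ ∸ k) ≡ + k
    index k k≤n′ = trans (pos-minus-pos-≥ (s≤s (ℕ.m∸n≤m n′ k))) (cong +_ (ℕ.m∸[m∸n]≡n k≤n′))

  lhs-≡-L : ∀ n′ → lhs m (suc n′) ≡ toℚ (L (suc n′) (+ suc n′)) * inv (suc n′)
  lhs-≡-L n′ = begin
    sumTo B (summand n)                               ≡⟨ sumTo-extend B n′ (summand n) B≤n′ vanish ⟨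
    sumTo n′ (summand n)                              ≡⟨ sumTo-cong n′ _ _ (summand-≡-scaledSummand n′) ⟩
    sumTo n′ (λ k → toℚ (scaledSummand n′ k) * inv n) ≡⟨ sumTo-toℚ n′ (scaledSummand n′) (inv n) ⟩
    toℚ (∑< n (scaledSummand n′)) * inv n             ≡⟨ cong (λ z → toℚ z * inv n) (L-diagonal n′) ⟨
    toℚ (L n (+ n)) * inv n                           ∎
    where
    n : ℕ
    n = suc n′
    B : ℕ
    B = (m ℕ.* n) ℕ./ suc m
    B≤n′ : B ℕ.≤ n′
    B≤n′ = ℕ.≤-pred (⌊mn/[m+1]⌋<n m n′)
    vanish : ∀ k → B ℕ.< k → k ℕ.≤ n′ → summand n k ≡ 0ℚ
    vanish k B<k k≤n′ = summand-vanishes n k B<k (ℕ.m≤n⇒m≤1+n k≤n′)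

open import Defs
open import Data.Nat using (ℕ; _≤_; _+_)
open import Data.Nat.Divisibility using (_∣_)
open import Data.Integer using (+_)
open import Data.Rational using (ℚ; _/_; -_; _*_)
open import Data.Product using (_×_)
open import Relation.Nullary using (¬_)
open import Relation.Binary.PropositionalEquality using (_≡_)

open import Data.Integer using (-[1+_])
open import Data.Nat using (suc; s≤s; z≤n)
open import Data.Nat.Properties using (≤-refl; +-comm)
open import Data.Product using (_,_; proj₁; proj₂)
open import Function using (_∘_)
open import Relation.Binary.PropositionalEquality using (cong; sym; subst; module ≡-Reasoning)
open ≡-Reasoning
open TruncatedLogDerivative using (L; LValueAt; L-value)
open RationalEmbedding using (toℚ; toℚ-[-1]*)
open LeftHandSide using (lhs-≡-L)

mainTheorem7 : (m : ℕ) → 1 ≤ m → (n : ℕ) → 1 ≤ n →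
    ((m + 2 ∣ n → lhs m n ≡ (+ (m + 1) / 1) * inv n) ×
    (¬ (m + 2 ∣ n) → lhs m n ≡ - inv n))
mainTheorem7 m _ (suc n′) _ = divisible , not-divisible
  where
  n : ℕ
  n = suc n′
  period : m + 2 ≡ suc (suc m)
  period = +-comm m 2
  value : LValueAt m n n
  value = L-value m n n (s≤s z≤n) ≤-refl
  divisible : m + 2 ∣ n → lhs m n ≡ (+ (m + 1) / 1) * inv n
  divisible m+2∣n = begin
    lhs m n                    ≡⟨ lhs-≡-L m n′ ⟩
    toℚ (L m n (+ n)) * inv n  ≡⟨ cong (λ z → toℚ z * inv n) (proj₁ value (subst (_∣ n) period m+2∣n)) ⟩
    toℚ (+ suc m) * inv n      ≡⟨ cong (λ k → toℚ (+ k) * inv n) (+-comm 1 m) ⟩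
    (+ (m + 1) / 1) * inv n    ∎
  not-divisible : ¬ (m + 2 ∣ n) → lhs m n ≡ - inv n
  not-divisible m+2∤n = begin
    lhs m n                    ≡⟨ lhs-≡-L m n′ ⟩
    toℚ (L m n (+ n)) * inv n  ≡⟨ cong (λ z → toℚ z * inv n) (proj₂ value (m+2∤n ∘ subst (_∣ n) (sym period))) ⟩
    toℚ -[1+ 0 ] * inv n       ≡⟨ toℚ-[-1]* (inv n) ⟩
    - inv n                    ∎
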